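{- Let $\Lambda$ be a solid partition, and let $\mathcal V_\Lambda=\{V(i,j,k):(i,j,k)\in\Lambda\}$ and $\mathcal V^\ast_\Lambda=\{V^\ast(i,j,k):(i,j,k)\in\Lambda\}$ be the multisets of volume and anti-volume numbers. Then $\mathcal V_\Lambda$ majorizes $\mathcal V^\ast_\Lambda$.
   Context: A solid partition $\Lambda$ is a finite subset of $\mathbb Z_{\ge0}^3$ that is a lower order ideal for the componentwise order: if $(i,j,k)\in\Lambda$ and $0\le p\le i$, $0\le q\le j$, $0\le r\le k$, then $(p,q,r)\in\Lambda$. For $(i,j,k)\in\Lambda$: $V(i,j,k)=|\{(p,q,r)\in\Lambda: i\le p,\ j\le q,\ k\le r\}|$ and $V^\ast(i,j,k)=|\{(p,q,r)\in\Lambda:p\le i,\ q\le j,\ r\le k\}|$. Majorization: for two multisets $\mathcal A,\mathcal B$ of $n$ real numbers with elements $a_1\ge\dots\ge a_n$ and $b_1\ge\dots\ge b_n$ in non-increasing order, $\mathcal A$ majorizes $\mathcal B$ if $a_1+\dots+a_k\ge b_1+\dots+b_k$ for all $1\le k<n$ and $a_1+\dots+a_n=b_1+\dots+b_n$. -}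

module Defs where

open import Data.Nat using (ℕ; _≤_; _≥_)
open import Data.Nat.Properties using (_≤?_)
open import Data.Product using (_×_; _,_)
open import Data.List using (List; []; _∷_; length; filter; map; take)
open import Data.Nat.ListAction using (sum)
open import Data.List.Membership.Propositional using (_∈_)
open import Data.List.Relation.Unary.Unique.Propositional using (Unique)
open import Data.List.Relation.Unary.Linked using (Linked)
open import Data.List.Relation.Binary.Permutation.Propositional using (_↭_)
open import Relation.Nullary.Decidable using (_×-dec_)
open import Relation.Binary.PropositionalEquality using (_≡_)

Point : Set
Point = ℕ × ℕ × ℕ

_≼_ : Point → Point → Set
(p , q , r) ≼ (i , j , k) = (p ≤ i) × (q ≤ j) × (r ≤ k)

_≼?_ : (x y : Point) → Relation.Nullary.Decidable.Dec (x ≼ y)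
(p , q , r) ≼? (i , j , k) = (p ≤? i) ×-dec ((q ≤? j) ×-dec (r ≤? k))

record SolidPartition : Set where
  field
    cells  : List Point
    unique : Unique cells
    lower  : ∀ {x y} → y ∈ cells → x ≼ y → x ∈ cells
open SolidPartition public

V : SolidPartition → Point → ℕ
V Λ x = length (filter (λ y → x ≼? y) (cells Λ))

V* : SolidPartition → Point → ℕ
V* Λ x = length (filter (λ y → y ≼? x) (cells Λ))

volumes : SolidPartition → List ℕ
volumes Λ = map (V Λ) (cells Λ)

antiVolumes : SolidPartition → List ℕ
antiVolumes Λ = map (V* Λ) (cells Λ)

NonIncreasing : List ℕ → Set
NonIncreasing = Linked _≥_

-- Majorization of multisets (represented as lists, taken up to permutation):
-- for any non-increasing arrangements a of A and b of B, the partial sums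
-- of a dominate those of b, and the total sums agree.
-- (Both multisets here have the same size n; prefixes with k ≥ n just
-- give the totals, so quantifying over all k is equivalent to 1 ≤ k < n.)
Majorizes : List ℕ → List ℕ → Set
Majorizes A B =
  length A ≡ length B ×
  (∀ a b → a ↭ A → b ↭ B → NonIncreasing a → NonIncreasing b →
     (∀ k → sum (take k b) ≤ sum (take k a)) × sum a ≡ sum b)

-- Fix k and let S be the k cells carrying the first k anti-volumes. The sum of V* over S
-- counts the pairs d ≼ z with z ∈ S, that is, the sum over d of |S ∩ ↑d|. Pushing S down
-- inside Λ along the x-, y- and z-axis in turn yields a set T ⊆ Λ with |T| = |S| such that
-- |S ∩ ↑d| ≤ |{p ∈ T : p + d ∈ Λ}| for every d, and the sum over d of the right-hand side is
-- the sum of V over T. So the k largest anti-volumes add up to at most the volumes of some k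
-- cells, hence to at most the k largest volumes; the totals agree, both being the number of
-- comparable pairs of cells. All sums are taken over a cube containing Λ.
module Submission where

open import Data.Nat using (ℕ; zero; suc; _+_; _*_; _∸_; _⊓_; _≤_; _<_; _≥_; z≤n; s≤s; _≤?_; _<?_; _≟_)
open import Data.Nat.Properties
open import Data.Nat.ListAction using (sum)
open import Data.Nat.ListAction.Properties using (sum-↭)
open import Data.Nat.Tactic.RingSolver using (solve-∀)
open import Algebra.Properties.CommutativeSemigroup +-commutativeSemigroup
  using () renaming (interchange to +-interchange)
open import Algebra.Properties.CommutativeSemigroup *-commutativeSemigroup using (x∙yz≈y∙xz)
open import Data.Product using (_×_; _,_; proj₁; proj₂; ∃-syntax; ∃₂)
open import Data.Product.Properties using (≡-dec)
open import Data.Sum using (inj₁; inj₂)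
open import Data.List using (List; []; _∷_; _++_; map; filter; length; take; drop)
open import Data.List.Properties using (++-assoc; map-++; length-map; length-take; take++drop≡id)
open import Data.List.Membership.Propositional using (_∈_; _∉_)
open import Data.List.Membership.Propositional.Properties using (∈-map⁺; ∈-map⁻; ∈-∃++; ∈-++⁺ˡ; ∈-++⁻)
import Data.List.Membership.DecPropositional as DecMembership
open import Data.List.Relation.Binary.Permutation.Propositional using (_↭_; prep; ↭-refl; ↭-sym; ↭-trans; ↭⇒↭ₛ)
open import Data.List.Relation.Binary.Permutation.Propositional.Properties
  using (∈-resp-↭; map⁺; shift; drop-∷; ↭-length; ++⁺ʳ)
import Data.List.Relation.Binary.Permutation.Setoid.Properties as PermutationSetoid
open import Data.List.Relation.Unary.All as All using (All; []; _∷_)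
import Data.List.Relation.Unary.All.Properties as All
open import Data.List.Relation.Unary.AllPairs using ([]; _∷_)
open import Data.List.Relation.Unary.Any using (here; there)
open import Data.List.Relation.Unary.Linked using (Linked; _∷_)
import Data.List.Relation.Unary.Linked as Linked
open import Data.List.Relation.Unary.Unique.Propositional using (Unique)
open import Data.List.Relation.Unary.Unique.Propositional.Properties using (Unique[x∷xs]⇒x∉xs)
open import Function using (_∘_)
open import Relation.Nullary using (Dec; yes; no; ¬_; ¬?; contradiction)
open import Relation.Nullary.Decidable using (_×-dec_)
open import Relation.Unary using (Decidable)
open import Relation.Binary.PropositionalEquality
open import Relation.Binary.PropositionalEquality.Properties using (setoid)

open import Defs

private variable
  P Q : Set

𝟙 : Dec P → ℕ
𝟙 (yes _) = 1
𝟙 (no _)  = 0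

𝟙≤1 : (P? : Dec P) → 𝟙 P? ≤ 1
𝟙≤1 (yes _) = s≤s z≤n
𝟙≤1 (no _)  = z≤n

𝟙-×-dec : (P? : Dec P) (Q? : Dec Q) → 𝟙 (P? ×-dec Q?) ≡ 𝟙 P? * 𝟙 Q?
𝟙-×-dec (yes _) (yes _) = refl
𝟙-×-dec (yes _) (no _)  = refl
𝟙-×-dec (no _)  _       = refl

𝟙-⇔ : (P → Q) → (Q → P) → (P? : Dec P) (Q? : Dec Q) → 𝟙 P? ≡ 𝟙 Q?
𝟙-⇔ _   _   (yes _) (yes _) = refl
𝟙-⇔ P⇒Q _   (yes p) (no ¬q) = contradiction (P⇒Q p) ¬q
𝟙-⇔ _   Q⇒P (no ¬p) (yes q) = contradiction (Q⇒P q) ¬p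
𝟙-⇔ _   _   (no _)  (no _)  = refl

𝟙-no : ¬ P → (P? : Dec P) → 𝟙 P? ≡ 0
𝟙-no ¬p (yes p) = contradiction p ¬p
𝟙-no _  (no _)  = refl

𝟙-⇒ : (P → Q) → (P? : Dec P) (Q? : Dec Q) → 𝟙 P? * 𝟙 Q? ≡ 𝟙 P?
𝟙-⇒ _   (yes _) (yes _) = refl
𝟙-⇒ P⇒Q (yes p) (no ¬q) = contradiction (P⇒Q p) ¬q
𝟙-⇒ _   (no _)  _       = refl

*-≡0ʳ : ∀ m {n} → n ≡ 0 → m * n ≡ 0
*-≡0ʳ m refl = *-zeroʳ m

∑< : ℕ → (ℕ → ℕ) → ℕ
∑< zero    f = 0
∑< (suc n) f = ∑< n f + f n

count : ℕ → {R : ℕ → Set} → Decidable R → ℕ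
count n R? = ∑< n (𝟙 ∘ R?)

∑<-cong : ∀ n {f g : ℕ → ℕ} → (∀ i → f i ≡ g i) → ∑< n f ≡ ∑< n g
∑<-cong zero    f≡g = refl
∑<-cong (suc n) f≡g = cong₂ _+_ (∑<-cong n f≡g) (f≡g n)

∑<-mono-≤ : ∀ n {f g : ℕ → ℕ} → (∀ i → f i ≤ g i) → ∑< n f ≤ ∑< n g
∑<-mono-≤ zero    f≤g = z≤n
∑<-mono-≤ (suc n) f≤g = +-mono-≤ (∑<-mono-≤ n f≤g) (f≤g n)

∑<-zero : ∀ n {f : ℕ → ℕ} → (∀ i → i < n → f i ≡ 0) → ∑< n f ≡ 0
∑<-zero zero    f≡0 = refl
∑<-zero (suc n) f≡0 = cong₂ _+_ (∑<-zero n (λ i i<n → f≡0 i (m≤n⇒m≤1+n i<n))) (f≡0 n ≤-refl)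

∑<-distrib-+ : ∀ n (f g : ℕ → ℕ) → ∑< n (λ i → f i + g i) ≡ ∑< n f + ∑< n g
∑<-distrib-+ zero    f g = refl
∑<-distrib-+ (suc n) f g =
  trans (cong (_+ (f n + g n)) (∑<-distrib-+ n f g)) (+-interchange (∑< n f) (∑< n g) (f n) (g n))

*-distribˡ-∑< : ∀ n c (f : ℕ → ℕ) → ∑< n (λ i → c * f i) ≡ c * ∑< n f
*-distribˡ-∑< zero    c f = sym (*-zeroʳ c)
*-distribˡ-∑< (suc n) c f =
  trans (cong (_+ c * f n) (*-distribˡ-∑< n c f)) (sym (*-distribˡ-+ c (∑< n f) (f n)))

∑<-comm : ∀ n m (f : ℕ → ℕ → ℕ) → ∑< n (λ i → ∑< m (f i)) ≡ ∑< m (λ j → ∑< n (λ i → f i j))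
∑<-comm zero    m f = sym (∑<-zero m (λ _ _ → refl))
∑<-comm (suc n) m f =
  trans (cong (_+ ∑< m (f n)) (∑<-comm n m f)) (sym (∑<-distrib-+ m (λ j → ∑< n (λ i → f i j)) (f n)))

count≤ : ∀ n {R : ℕ → Set} (R? : Decidable R) → count n R? ≤ n
count≤ zero    R? = z≤n
count≤ (suc n) R? = ≤-trans (+-mono-≤ (count≤ n R?) (𝟙≤1 (R? n))) (≤-reflexive (+-comm n 1))

count-< : ∀ n m → m ≤ n → count n (_<? m) ≡ m
count-< n m m≤n = trans (count-<-⊓ n) (m≥n⇒m⊓n≡n m≤n)
  where
  count-<-⊓ : ∀ n → count n (_<? m) ≡ n ⊓ m
  count-<-⊓ zero = refl
  count-<-⊓ (suc n) with n <? m
  ... | yes n<m = trans (cong (_+ 1) (trans (count-<-⊓ n) (m≤n⇒m⊓n≡m (<⇒≤ n<m))))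
                        (trans (+-comm n 1) (sym (m≤n⇒m⊓n≡m n<m)))
  ... | no  n≮m = trans (cong (_+ 0) (trans (count-<-⊓ n) (m≥n⇒m⊓n≡n (≮⇒≥ n≮m))))
                        (trans (+-identityʳ m) (sym (m≥n⇒m⊓n≡n (m≤n⇒m≤1+n (≮⇒≥ n≮m)))))

count-<-count : ∀ n {R : ℕ → Set} (R? : Decidable R) → count n (_<? count n R?) ≡ count n R?
count-<-count n R? = count-< n (count n R?) (count≤ n R?)

module _ {R : ℕ → Set} (R? : Decidable R) (a : ℕ) where

  count≥ : ℕ → ℕ
  count≥ n = ∑< n (λ e → 𝟙 (a ≤? e) * 𝟙 (R? e))

  count≥≤n∸a : ∀ n → count≥ n ≤ n ∸ a
  count≥≤n∸a zero = z≤n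
  count≥≤n∸a (suc n) with a ≤? n | R? n
  ... | yes a≤n | yes _ = begin
    count≥ n + 1 ≤⟨ +-monoˡ-≤ 1 (count≥≤n∸a n) ⟩
    n ∸ a + 1    ≡⟨ +-comm (n ∸ a) 1 ⟩
    1 + (n ∸ a)  ≡⟨ +-∸-assoc 1 a≤n ⟨
    suc n ∸ a    ∎
    where open ≤-Reasoning
  ... | yes _   | no _  = ≤-trans (≤-reflexive (+-identityʳ _)) (≤-trans (count≥≤n∸a n) (∸-monoˡ-≤ a (n≤1+n n)))
  ... | no _    | _     = ≤-trans (≤-reflexive (+-identityʳ _)) (≤-trans (count≥≤n∸a n) (∸-monoˡ-≤ a (n≤1+n n)))

  count≥⇒witness : ∀ n j → j < count≥ n → ∃[ e ] a + j ≤ e × R e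
  count≥⇒witness (suc n) j j<c with a ≤? n | R? n | count≥≤n∸a n
  ... | yes a≤n | yes r | c≤n∸a = n , a+j≤n , r
    where
    j≤n∸a : j ≤ n ∸ a
    j≤n∸a = ≤-trans (≤-pred (≤-trans j<c (≤-reflexive (+-comm (count≥ n) 1)))) c≤n∸a
    a+j≤n : a + j ≤ n
    a+j≤n = ≤-trans (+-monoʳ-≤ a j≤n∸a) (≤-reflexive (m+[n∸m]≡n a≤n))
  ... | yes _ | no _ | _ = count≥⇒witness n j (≤-trans j<c (≤-reflexive (+-identityʳ _)))
  ... | no _  | _    | _ = count≥⇒witness n j (≤-trans j<c (≤-reflexive (+-identityʳ _)))

count⇒witness : ∀ {R : ℕ → Set} (R? : Decidable R) n j → j < count n R? → ∃[ e ] j ≤ e × R e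
count⇒witness R? n j j<c =
  count≥⇒witness R? 0 n j (≤-trans j<c (≤-reflexive (∑<-cong n (λ e → sym (+-identityʳ (𝟙 (R? e)))))))

-- If ℓ elements e ≥ a satisfy P ∧ Q, the largest is ≥ a + ℓ − 1; as Q is downward
-- closed, Q (j + a) holds for all j < ℓ, and ℓ ≤ count P.
module _ (n : ℕ) {P Q : ℕ → Set} (P? : Decidable P) (Q? : Decidable Q)
         (Q-down : ∀ {e e′} → e′ ≤ e → Q e → Q e′) (a : ℕ) where

  private
    PQ? : Decidable (λ e → P e × Q e)
    PQ? e = P? e ×-dec Q? e

    ℓ : ℕ
    ℓ = ∑< n (λ e → 𝟙 (a ≤? e) * (𝟙 (P? e) * 𝟙 (Q? e)))

    ℓ≡count≥ : ℓ ≡ count≥ PQ? a n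
    ℓ≡count≥ = ∑<-cong n (λ e → cong (𝟙 (a ≤? e) *_) (sym (𝟙-×-dec (P? e) (Q? e))))

    term≤𝟙P : ∀ e → 𝟙 (a ≤? e) * (𝟙 (P? e) * 𝟙 (Q? e)) ≤ 𝟙 (P? e)
    term≤𝟙P e with a ≤? e | P? e | Q? e
    ... | yes _ | yes _ | yes _ = ≤-refl
    ... | yes _ | yes _ | no _  = z≤n
    ... | yes _ | no _  | _     = z≤n
    ... | no _  | _     | _     = z≤n

    ℓ≤count : ℓ ≤ count n P?
    ℓ≤count = ∑<-mono-≤ n term≤𝟙P

    ℓ≤n : ℓ ≤ n
    ℓ≤n = ≤-trans ℓ≤count (count≤ n P?)

    below-ℓ : ∀ j → 𝟙 (j <? ℓ) ≤ 𝟙 (j <? count n P?) * 𝟙 (Q? (j + a))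
    below-ℓ j with j <? ℓ
    ... | no _ = z≤n
    ... | yes j<ℓ with j <? count n P? | Q? (j + a)
    ...   | yes _   | yes _  = ≤-refl
    ...   | no j≮c  | _      = contradiction (<-≤-trans j<ℓ ℓ≤count) j≮c
    ...   | yes _   | no ¬q with count≥⇒witness PQ? a n j (subst (j <_) ℓ≡count≥ j<ℓ)
    ...     | e , a+j≤e , (_ , qe) = contradiction (Q-down (≤-trans (≤-reflexive (+-comm j a)) a+j≤e) qe) ¬q

  compress-line : ∑< n (λ e → 𝟙 (a ≤? e) * (𝟙 (P? e) * 𝟙 (Q? e)))
                ≤ ∑< n (λ j → 𝟙 (j <? count n P?) * 𝟙 (Q? (j + a)))
  compress-line = ≤-trans (≤-reflexive (sym (count-< n ℓ ℓ≤n))) (∑<-mono-≤ n below-ℓ)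

∑<-shift : ∀ (g : ℕ → ℕ) u m → ∑< m (λ d → g (u + d)) ≡ ∑< (u + m) (λ y → 𝟙 (u ≤? y) * g y)
∑<-shift g u zero = begin
  0                                            ≡⟨ ∑<-zero u (λ y y<u → cong (_* g y) (𝟙-no (<⇒≱ y<u) (u ≤? y))) ⟨
  ∑< u (λ y → 𝟙 (u ≤? y) * g y)              ≡⟨ cong (λ k → ∑< k (λ y → 𝟙 (u ≤? y) * g y)) (+-identityʳ u) ⟨
  ∑< (u + 0) (λ y → 𝟙 (u ≤? y) * g y)        ∎
  where open ≡-Reasoning
∑<-shift g u (suc m) rewrite +-suc u m with u ≤? u + m
... | yes _   = cong₂ _+_ (∑<-shift g u m) (sym (+-identityʳ (g (u + m))))
... | no  u≰ = contradiction (m≤m+n u m) u≰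

∑<-tail-zero : ∀ n k {h : ℕ → ℕ} → (∀ i → n ≤ i → h i ≡ 0) → ∑< (n + k) h ≡ ∑< n h
∑<-tail-zero n zero {h} h-out = cong (λ k → ∑< k h) (+-identityʳ n)
∑<-tail-zero n (suc k) h-out rewrite +-suc n k =
  trans (cong₂ _+_ (∑<-tail-zero n k h-out) (h-out (n + k) (m≤m+n n k))) (+-identityʳ _)

∑<-translate : ∀ n u {g : ℕ → ℕ} → (∀ i → n ≤ i → g i ≡ 0) →
               ∑< n (λ d → g (u + d)) ≡ ∑< n (λ y → 𝟙 (u ≤? y) * g y)
∑<-translate n u {g} g-out = begin
  ∑< n (λ d → g (u + d))                 ≡⟨ ∑<-shift g u n ⟩
  ∑< (u + n) (λ y → 𝟙 (u ≤? y) * g y)   ≡⟨ cong (λ k → ∑< k (λ y → 𝟙 (u ≤? y) * g y)) (+-comm u n) ⟩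
  ∑< (n + u) (λ y → 𝟙 (u ≤? y) * g y)   ≡⟨ ∑<-tail-zero n u (λ i n≤i → *-≡0ʳ (𝟙 (u ≤? i)) (g-out i n≤i)) ⟩
  ∑< n (λ y → 𝟙 (u ≤? y) * g y)         ∎
  where open ≡-Reasoning

_⊕_ : Point → Point → Point
(x , y , z) ⊕ (a , b , c) = (x + a , y + b , z + c)

∑³ : ℕ → (Point → ℕ) → ℕ
∑³ n g = ∑< n (λ x → ∑< n (λ y → ∑< n (λ z → g (x , y , z))))

∑³-cong : ∀ n {f g : Point → ℕ} → (∀ p → f p ≡ g p) → ∑³ n f ≡ ∑³ n g
∑³-cong n f≡g = ∑<-cong n (λ x → ∑<-cong n (λ y → ∑<-cong n (λ z → f≡g (x , y , z))))

∑³-mono-≤ : ∀ n {f g : Point → ℕ} → (∀ p → f p ≤ g p) → ∑³ n f ≤ ∑³ n g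
∑³-mono-≤ n f≤g = ∑<-mono-≤ n (λ x → ∑<-mono-≤ n (λ y → ∑<-mono-≤ n (λ z → f≤g (x , y , z))))

∑³-distrib-+ : ∀ n (f g : Point → ℕ) → ∑³ n (λ p → f p + g p) ≡ ∑³ n f + ∑³ n g
∑³-distrib-+ n f g =
  trans (∑<-cong n (λ x → trans (∑<-cong n (λ y → ∑<-distrib-+ n _ _)) (∑<-distrib-+ n _ _)))
        (∑<-distrib-+ n _ _)

*-distribˡ-∑³ : ∀ n c (f : Point → ℕ) → ∑³ n (λ p → c * f p) ≡ c * ∑³ n f
*-distribˡ-∑³ n c f =
  trans (∑<-cong n (λ x → trans (∑<-cong n (λ y → *-distribˡ-∑< n c _)) (*-distribˡ-∑< n c _)))
        (*-distribˡ-∑< n c _)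

∑<-∑³-comm : ∀ n m (g : ℕ → Point → ℕ) → ∑< m (λ i → ∑³ n (g i)) ≡ ∑³ n (λ p → ∑< m (λ i → g i p))
∑<-∑³-comm n m g =
  trans (∑<-comm m n _) (∑<-cong n (λ x →
  trans (∑<-comm m n _) (∑<-cong n (λ y → ∑<-comm m n _))))

∑³-comm : ∀ n (h : Point → Point → ℕ) → ∑³ n (λ p → ∑³ n (h p)) ≡ ∑³ n (λ q → ∑³ n (λ p → h p q))
∑³-comm n h =
  trans (∑<-cong n (λ x → trans (∑<-cong n (λ y → ∑<-∑³-comm n n _)) (∑<-∑³-comm n n _)))
        (∑<-∑³-comm n n _)

∑³-comm-*ˡ : ∀ n (w : Point → ℕ) (h : Point → Point → ℕ) →
             ∑³ n (λ p → w p * ∑³ n (h p)) ≡ ∑³ n (λ q → ∑³ n (λ p → w p * h p q))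
∑³-comm-*ˡ n w h = trans (∑³-cong n (λ p → sym (*-distribˡ-∑³ n (w p) (h p)))) (∑³-comm n _)

∑<³-reverse : ∀ n (F : ℕ → ℕ → ℕ → ℕ) →
  ∑< n (λ x → ∑< n (λ y → ∑< n (F x y))) ≡ ∑< n (λ z → ∑< n (λ y → ∑< n (λ x → F x y z)))
∑<³-reverse n F =
  trans (∑<-cong n (λ x → ∑<-comm n n (F x)))
        (trans (∑<-comm n n _) (∑<-cong n (λ z → ∑<-comm n n _)))

∑<³-rotate : ∀ n (F : ℕ → ℕ → ℕ → ℕ) →
  ∑< n (λ z → ∑< n (λ x → ∑< n (λ y → F x y z))) ≡ ∑< n (λ x → ∑< n (λ y → ∑< n (F x y)))
∑<³-rotate n F = trans (∑<-comm n n _) (∑<-cong n (λ x → ∑<-comm n n _))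

𝟙-≼ : ∀ a b c x y z → 𝟙 ((a , b , c) ≼? (x , y , z)) ≡ 𝟙 (a ≤? x) * (𝟙 (b ≤? y) * 𝟙 (c ≤? z))
𝟙-≼ a b c x y z = trans (𝟙-×-dec (a ≤? x) _) (cong (𝟙 (a ≤? x) *_) (𝟙-×-dec (b ≤? y) _))

InBox : ℕ → Point → Set
InBox n (x , y , z) = x < n × y < n × z < n

∑³-translate : ∀ n {g : Point → ℕ} → (∀ q → ¬ InBox n q → g q ≡ 0) →
               ∀ p → ∑³ n (λ d → g (p ⊕ d)) ≡ ∑³ n (λ q → 𝟙 (p ≼? q) * g q)
∑³-translate n {g} g-out (x , y , z) = begin
  ∑< n (λ a → ∑< n (λ b → ∑< n (λ c → g (x + a , y + b , z + c))))
    ≡⟨ ∑<-cong n (λ a → ∑<-cong n (λ b → ∑<-translate n z (λ c n≤c → g-out _ (out₃ n≤c)))) ⟩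
  ∑< n (λ a → ∑< n (λ b → Gᶻ (x + a) (y + b)))
    ≡⟨ ∑<-cong n (λ a → ∑<-translate n y (λ b n≤b → Gᶻ-out (out₂ n≤b))) ⟩
  ∑< n (λ a → Gʸᶻ (x + a))
    ≡⟨ ∑<-translate n x (λ a n≤a → ∑<-zero n (λ b _ → *-≡0ʳ (𝟙 (y ≤? b)) (Gᶻ-out (out₁ n≤a)))) ⟩
  ∑< n (λ a → 𝟙 (x ≤? a) * Gʸᶻ a)
    ≡⟨ ∑<-cong n (λ a → trans (sym (*-distribˡ-∑< n (𝟙 (x ≤? a)) _)) (∑<-cong n (λ b →
         trans (cong (𝟙 (x ≤? a) *_) (sym (*-distribˡ-∑< n (𝟙 (y ≤? b)) _)))
               (trans (sym (*-distribˡ-∑< n (𝟙 (x ≤? a)) _)) (∑<-cong n (λ c → collect a b c)))))) ⟩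
  ∑³ n (λ q → 𝟙 ((x , y , z) ≼? q) * g q) ∎
  where
  open ≡-Reasoning
  Gᶻ : ℕ → ℕ → ℕ
  Gᶻ a b = ∑< n (λ c → 𝟙 (z ≤? c) * g (a , b , c))
  Gʸᶻ : ℕ → ℕ
  Gʸᶻ a = ∑< n (λ b → 𝟙 (y ≤? b) * Gᶻ a b)

  out₁ : ∀ {a b c} → n ≤ a → ¬ InBox n (a , b , c)
  out₁ n≤a (a<n , _) = <⇒≱ a<n n≤a
  out₂ : ∀ {a b c} → n ≤ b → ¬ InBox n (a , b , c)
  out₂ n≤b (_ , b<n , _) = <⇒≱ b<n n≤b
  out₃ : ∀ {a b c} → n ≤ c → ¬ InBox n (a , b , c)
  out₃ n≤c (_ , _ , c<n) = <⇒≱ c<n n≤c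

  Gᶻ-out : ∀ {a b} → (∀ {c} → ¬ InBox n (a , b , c)) → Gᶻ a b ≡ 0
  Gᶻ-out out = ∑<-zero n (λ c _ → *-≡0ʳ (𝟙 (z ≤? c)) (g-out _ out))

  collect : ∀ a b c → 𝟙 (x ≤? a) * (𝟙 (y ≤? b) * (𝟙 (z ≤? c) * g (a , b , c)))
                    ≡ 𝟙 ((x , y , z) ≼? (a , b , c)) * g (a , b , c)
  collect a b c = trans (reassoc (𝟙 (x ≤? a)) (𝟙 (y ≤? b)) (𝟙 (z ≤? c)) (g (a , b , c)))
                        (cong (_* g (a , b , c)) (sym (𝟙-≼ x y z a b c)))
    where
    reassoc : ∀ a b c d → a * (b * (c * d)) ≡ a * (b * c) * d
    reassoc = solve-∀

-- S is pushed down along x, then y, then z: afterwards its line through (·, y, z) is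
-- [0, lenˣ y z); pushing that set down along y makes its line through (x, ·, z)
-- [0, lenʸ x z); and pushing down along z leaves [0, lenᶻ x y) on the line through (x, y, ·).
module Compression (n : ℕ) {S L : Point → Set} (S? : Decidable S) (L? : Decidable L)
  (S⊆L : ∀ {p} → S p → L p) (L-down : ∀ {p q} → L p → q ≼ p → L q) where

  lenˣ lenʸ lenᶻ : ℕ → ℕ → ℕ
  lenˣ y z = count n (λ x → S? (x , y , z))
  lenʸ x z = count n (λ y → x <? lenˣ y z)
  lenᶻ x y = count n (λ z → y <? lenʸ x z)

  Compressed : Point → Set
  Compressed (x , y , z) = z < lenᶻ x y

  compressed? : Decidable Compressed
  compressed? (x , y , z) = z <? lenᶻ x y

  Compressed⊆L : ∀ {p} → Compressed p → L p
  Compressed⊆L {x , y , z} z<lenᶻ with count⇒witness (λ z′ → y <? lenʸ x z′) n z z<lenᶻ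
  ... | z′ , z≤z′ , y<lenʸ with count⇒witness (λ y′ → x <? lenˣ y′ z′) n y y<lenʸ
  ... | y′ , y≤y′ , x<lenˣ with count⇒witness (λ x′ → S? (x′ , y′ , z′)) n x x<lenˣ
  ... | x′ , x≤x′ , s = L-down (S⊆L s) (x≤x′ , y≤y′ , z≤z′)

  ∣Compressed∣≡∣S∣ : ∑³ n (𝟙 ∘ compressed?) ≡ ∑³ n (𝟙 ∘ S?)
  ∣Compressed∣≡∣S∣ = begin
    ∑< n (λ x → ∑< n (λ y → count n (λ z → z <? lenᶻ x y)))
      ≡⟨ ∑<-cong n (λ x → ∑<-cong n (λ y → count-<-count n _)) ⟩
    ∑< n (λ x → ∑< n (λ y → count n (λ z → y <? lenʸ x z)))
      ≡⟨ ∑<-cong n (λ x → ∑<-comm n n _) ⟩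
    ∑< n (λ x → ∑< n (λ z → count n (λ y → y <? lenʸ x z)))
      ≡⟨ ∑<-cong n (λ x → ∑<-cong n (λ z → count-<-count n _)) ⟩
    ∑< n (λ x → ∑< n (λ z → count n (λ y → x <? lenˣ y z)))
      ≡⟨ ∑<-comm n n _ ⟩
    ∑< n (λ z → ∑< n (λ x → count n (λ y → x <? lenˣ y z)))
      ≡⟨ ∑<-cong n (λ z → ∑<-comm n n _) ⟩
    ∑< n (λ z → ∑< n (λ y → count n (λ x → x <? lenˣ y z)))
      ≡⟨ ∑<-cong n (λ z → ∑<-cong n (λ y → count-<-count n _)) ⟩
    ∑< n (λ z → ∑< n (λ y → count n (λ x → S? (x , y , z))))
      ≡⟨ ∑<³-reverse n (λ x y z → 𝟙 (S? (x , y , z))) ⟨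
    ∑³ n (𝟙 ∘ S?) ∎
    where open ≡-Reasoning

  compression-shift : ∀ d → ∑³ n (λ p → 𝟙 (S? p) * 𝟙 (d ≼? p))
                          ≤ ∑³ n (λ p → 𝟙 (compressed? p) * 𝟙 (L? (p ⊕ d)))
  compression-shift (a , b , c) = begin
    ∑³ n (λ p → 𝟙 (S? p) * 𝟙 ((a , b , c) ≼? p))
      ≡⟨ ∑³-cong n (λ (x , y , z) → separate x y z) ⟩
    ∑< n (λ x → ∑< n (λ y → ∑< n (λ z → C z * (B y * (A x * 𝟙 (S? (x , y , z)))))))
      ≡⟨ ∑<³-reverse n _ ⟩
    ∑< n (λ z → ∑< n (λ y → ∑< n (λ x → C z * (B y * (A x * 𝟙 (S? (x , y , z)))))))
      ≡⟨ ∑<-cong n (λ z → trans (∑<-cong n (λ y → *-distribˡ-∑< n (C z) _)) (*-distribˡ-∑< n (C z) _)) ⟩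
    ∑< n (λ z → C z * ∑< n (λ y → ∑< n (λ x → B y * (A x * 𝟙 (S? (x , y , z))))))
      ≡⟨ ∑<-cong n (λ z → cong (C z *_) (∑<-cong n (λ y → *-distribˡ-∑< n (B y) _))) ⟩
    ∑< n (λ z → C z * ∑< n (λ y → B y * ∑< n (λ x → A x * 𝟙 (S? (x , y , z)))))
      ≤⟨ ∑<-mono-≤ n (λ z → *-monoʳ-≤ (C z) (∑<-mono-≤ n (λ y → *-monoʳ-≤ (B y) (compress-x y z)))) ⟩
    ∑< n (λ z → C z * ∑< n (λ y → B y * ∑< n (λ x → X x y z)))
      ≡⟨ ∑<-cong n (λ z → cong (C z *_) (trans (∑<-cong n (λ y → sym (*-distribˡ-∑< n (B y) _)))
                                                (∑<-comm n n _))) ⟩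
    ∑< n (λ z → C z * ∑< n (λ x → ∑< n (λ y → B y * X x y z)))
      ≤⟨ ∑<-mono-≤ n (λ z → *-monoʳ-≤ (C z) (∑<-mono-≤ n (λ x → compress-y x z))) ⟩
    ∑< n (λ z → C z * ∑< n (λ x → ∑< n (λ y → Y x y z)))
      ≡⟨ ∑<-cong n (λ z → trans (sym (*-distribˡ-∑< n (C z) _)) (∑<-cong n (λ x → sym (*-distribˡ-∑< n (C z) _)))) ⟩
    ∑< n (λ z → ∑< n (λ x → ∑< n (λ y → C z * Y x y z)))
      ≡⟨ ∑<³-rotate n (λ x y z → C z * Y x y z) ⟩
    ∑< n (λ x → ∑< n (λ y → ∑< n (λ z → C z * Y x y z)))
      ≤⟨ ∑<-mono-≤ n (λ x → ∑<-mono-≤ n (λ y → compress-z x y)) ⟩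
    ∑³ n (λ p → 𝟙 (compressed? p) * 𝟙 (L? (p ⊕ (a , b , c)))) ∎
    where
    open ≤-Reasoning
    A B C : ℕ → ℕ
    A x = 𝟙 (a ≤? x)
    B y = 𝟙 (b ≤? y)
    C z = 𝟙 (c ≤? z)
    X Y : ℕ → ℕ → ℕ → ℕ
    X x y z = 𝟙 (x <? lenˣ y z) * 𝟙 (L? (x + a , y , z))
    Y x y z = 𝟙 (y <? lenʸ x z) * 𝟙 (L? (x + a , y + b , z))

    separate : ∀ x y z → 𝟙 (S? (x , y , z)) * 𝟙 ((a , b , c) ≼? (x , y , z))
                       ≡ C z * (B y * (A x * 𝟙 (S? (x , y , z))))
    separate x y z = trans (cong (𝟙 (S? (x , y , z)) *_) (𝟙-≼ a b c x y z))
                           (rearrange (𝟙 (S? (x , y , z))) (A x) (B y) (C z))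
      where
      rearrange : ∀ s a b c → s * (a * (b * c)) ≡ c * (b * (a * s))
      rearrange = solve-∀

    compress-x : ∀ y z → ∑< n (λ x → A x * 𝟙 (S? (x , y , z))) ≤ ∑< n (λ x → X x y z)
    compress-x y z = begin
      ∑< n (λ x → A x * 𝟙 (S? (x , y , z)))
        ≡⟨ ∑<-cong n (λ x → cong (A x *_) (𝟙-⇒ S⊆L (S? (x , y , z)) (L? (x , y , z)))) ⟨
      ∑< n (λ x → A x * (𝟙 (S? (x , y , z)) * 𝟙 (L? (x , y , z))))
        ≤⟨ compress-line n (λ x → S? (x , y , z)) (λ x → L? (x , y , z))
                         (λ x′≤x l → L-down l (x′≤x , ≤-refl , ≤-refl)) a ⟩
      ∑< n (λ x → X x y z) ∎

    compress-y : ∀ x z → ∑< n (λ y → B y * X x y z) ≤ ∑< n (λ y → Y x y z)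
    compress-y x z = compress-line n (λ y → x <? lenˣ y z) (λ y → L? (x + a , y , z))
                                   (λ y′≤y l → L-down l (≤-refl , y′≤y , ≤-refl)) b

    compress-z : ∀ x y → ∑< n (λ z → C z * Y x y z)
                       ≤ ∑< n (λ z → 𝟙 (z <? lenᶻ x y) * 𝟙 (L? (x + a , y + b , z + c)))
    compress-z x y = compress-line n (λ z → y <? lenʸ x z) (λ z → L? (x + a , y + b , z))
                                   (λ z′≤z l → L-down l (≤-refl , ≤-refl , z′≤z)) c

module _ {A : Set} {P : A → Set} (P? : Decidable P) where

  sum-map-filter : ∀ (f : A → ℕ) l → sum (map f (filter P? l)) ≡ sum (map (λ x → 𝟙 (P? x) * f x) l)
  sum-map-filter f []      = refl
  sum-map-filter f (x ∷ l) with P? x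
  ... | yes _ = cong₂ _+_ (sym (+-identityʳ (f x))) (sum-map-filter f l)
  ... | no _  = sum-map-filter f l

  length-filter≡sum : ∀ l → length (filter P? l) ≡ sum (map (𝟙 ∘ P?) l)
  length-filter≡sum []      = refl
  length-filter≡sum (x ∷ l) with P? x
  ... | yes _ = cong suc (length-filter≡sum l)
  ... | no _  = length-filter≡sum l

Unique-resp-↭ : ∀ {A : Set} {xs ys : List A} → xs ↭ ys → Unique xs → Unique ys
Unique-resp-↭ {A} p = PermutationSetoid.Unique-resp-↭ (setoid A) (↭⇒↭ₛ p)

Unique-++⁻ˡ : ∀ {A : Set} (xs : List A) {ys} → Unique (xs ++ ys) → Unique xs
Unique-++⁻ˡ []       _          = []
Unique-++⁻ˡ (x ∷ xs) (x∉ ∷ xs!) = All.++⁻ˡ xs x∉ ∷ Unique-++⁻ˡ xs xs!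

length≡sum-map-1 : ∀ {A : Set} (l : List A) → length l ≡ sum (map (λ _ → 1) l)
length≡sum-map-1 []      = refl
length≡sum-map-1 (x ∷ l) = cong suc (length≡sum-map-1 l)

∈⇒≤sum : ∀ {m ns} → m ∈ ns → m ≤ sum ns
∈⇒≤sum (here refl)              = m≤m+n _ _
∈⇒≤sum {ns = n ∷ _} (there m∈) = ≤-trans (∈⇒≤sum m∈) (m≤n+m _ n)

split-map-↭ : ∀ {A : Set} (f : A → ℕ) xs ys (zs : List A) → xs ++ ys ↭ map f zs →
              ∃₂ λ S R → zs ↭ S ++ R × map f S ≡ xs
split-map-↭ f []       ys zs p = [] , zs , ↭-refl , refl
split-map-↭ f (x ∷ xs) ys zs p with ∈-map⁻ f (∈-resp-↭ p (here refl))
... | z , z∈zs , refl with ∈-∃++ z∈zs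
... | us , vs , refl with split-map-↭ f xs ys (us ++ vs) (drop-∷ (↭-trans p (map⁺ f (shift z us vs))))
... | S , R , us++vs↭S++R , fS≡xs =
  z ∷ S , R , ↭-trans (shift z us vs) (prep z us++vs↭S++R) , cong (f z ∷_) fS≡xs

↭-filter-++ : ∀ {A : Set} {P : A → Set} (P? : Decidable P) xs → xs ↭ filter P? xs ++ filter (¬? ∘ P?) xs
↭-filter-++ P? []       = ↭-refl
↭-filter-++ P? (x ∷ xs) with P? x
... | yes _ = prep x (↭-filter-++ P? xs)
... | no _  = ↭-trans (prep x (↭-filter-++ P? xs)) (↭-sym (shift x (filter P? xs) _))

sum-take-∷-mono : ∀ y a → Linked _≥_ (y ∷ a) → ∀ k → sum (take k a) ≤ sum (take k (y ∷ a))
sum-take-∷-mono y a       _             zero    = z≤n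
sum-take-∷-mono y []      _             (suc k) = z≤n
sum-take-∷-mono y (x ∷ a) (y≥x ∷ x∷a↓) (suc k) = +-mono-≤ y≥x (sum-take-∷-mono x a x∷a↓ k)

-- The head a₀ of the sorted list lies either in xs, where it is matched by the head of
-- take k a, or in ys, where removing it from a only lowers the prefix sums.
sum≤sum-take : ∀ a → Linked _≥_ a → ∀ xs ys k → xs ++ ys ↭ a → length xs ≤ k → sum xs ≤ sum (take k a)
sum≤sum-take []       _  []       ys k p _ = z≤n
sum≤sum-take []       _  (x ∷ xs) ys k p _ with ↭-length p
... | ()
sum≤sum-take (a₀ ∷ a) a↓ xs ys k p |xs|≤k with ∈-++⁻ xs (∈-resp-↭ (↭-sym p) (here refl))
... | inj₁ a₀∈xs with ∈-∃++ a₀∈xs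
...   | us , vs , refl = a₀-chosen (≤-trans (≤-reflexive (↭-length (↭-sym (shift a₀ us vs)))) |xs|≤k)
  where
  a₀-chosen : suc (length (us ++ vs)) ≤ k → sum (us ++ a₀ ∷ vs) ≤ sum (take k (a₀ ∷ a))
  a₀-chosen (s≤s {n = k′} |us++vs|≤k′) = begin
    sum (us ++ a₀ ∷ vs)  ≡⟨ sum-↭ (shift a₀ us vs) ⟩
    a₀ + sum (us ++ vs)  ≤⟨ +-monoʳ-≤ a₀ (sum≤sum-take a (Linked.tail a↓) (us ++ vs) ys k′ p′ |us++vs|≤k′) ⟩
    sum (take (suc k′) (a₀ ∷ a)) ∎
    where
    open ≤-Reasoning
    p′ : (us ++ vs) ++ ys ↭ a
    p′ = drop-∷ (↭-trans (↭-sym (++⁺ʳ ys (shift a₀ us vs))) p)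
sum≤sum-take (a₀ ∷ a) a↓ xs ys k p |xs|≤k | inj₂ a₀∈ys with ∈-∃++ a₀∈ys
...   | us , vs , refl = ≤-trans (sum≤sum-take a (Linked.tail a↓) xs (us ++ vs) k p′ |xs|≤k)
                                 (sum-take-∷-mono a₀ a a↓ k)
  where
  p′ : xs ++ us ++ vs ↭ a
  p′ = drop-∷ (↭-trans (↭-sym (subst₂ _↭_ (++-assoc xs us (a₀ ∷ vs)) (cong (a₀ ∷_) (++-assoc xs us vs))
                                               (shift a₀ (xs ++ us) vs)))
                       p)

_≟ₚ_ : (p q : Point) → Dec (p ≡ q)
_≟ₚ_ = ≡-dec _≟_ (≡-dec _≟_ _≟_)

open DecMembership _≟ₚ_ using (_∈?_)

∑<-δ-out : ∀ n j (f : ℕ → ℕ) → n ≤ j → ∑< n (λ i → 𝟙 (i ≟ j) * f i) ≡ 0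
∑<-δ-out n j f n≤j = ∑<-zero n (λ i i<n → cong (_* f i) (𝟙-no (λ { refl → <⇒≱ i<n n≤j }) (i ≟ j)))

∑<-δ : ∀ n j (f : ℕ → ℕ) → j < n → ∑< n (λ i → 𝟙 (i ≟ j) * f i) ≡ f j
∑<-δ (suc n) j f j<1+n with n ≟ j
... | yes refl = trans (cong (_+ (f n + 0)) (∑<-δ-out n n f ≤-refl)) (+-identityʳ (f n))
... | no  n≢j  = trans (cong (_+ 0) (∑<-δ n j f (≤∧≢⇒< (≤-pred j<1+n) (n≢j ∘ sym)))) (+-identityʳ (f j))

𝟙-≟ₚ : ∀ x y z a b c → 𝟙 ((x , y , z) ≟ₚ (a , b , c)) ≡ 𝟙 (x ≟ a) * (𝟙 (y ≟ b) * 𝟙 (z ≟ c))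
𝟙-≟ₚ x y z a b c = begin
  𝟙 ((x , y , z) ≟ₚ (a , b , c))
    ≡⟨ 𝟙-⇔ (λ { refl → refl , refl , refl }) (λ { (refl , refl , refl) → refl })
            ((x , y , z) ≟ₚ (a , b , c)) ((x ≟ a) ×-dec ((y ≟ b) ×-dec (z ≟ c))) ⟩
  𝟙 ((x ≟ a) ×-dec ((y ≟ b) ×-dec (z ≟ c)))
    ≡⟨ 𝟙-×-dec (x ≟ a) _ ⟩
  𝟙 (x ≟ a) * 𝟙 ((y ≟ b) ×-dec (z ≟ c))
    ≡⟨ cong (𝟙 (x ≟ a) *_) (𝟙-×-dec (y ≟ b) _) ⟩
  𝟙 (x ≟ a) * (𝟙 (y ≟ b) * 𝟙 (z ≟ c)) ∎
  where open ≡-Reasoning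

∑³-δ : ∀ n (f : Point → ℕ) q → InBox n q → ∑³ n (λ p → 𝟙 (p ≟ₚ q) * f p) ≡ f q
∑³-δ n f (a , b , c) (a<n , b<n , c<n) = begin
  ∑³ n (λ p → 𝟙 (p ≟ₚ (a , b , c)) * f p)
    ≡⟨ ∑<-cong n (λ x → ∑<-cong n (λ y → ∑<-cong n (λ z → separate x y z))) ⟩
  ∑< n (λ x → ∑< n (λ y → ∑< n (λ z → 𝟙 (x ≟ a) * (𝟙 (y ≟ b) * (𝟙 (z ≟ c) * f (x , y , z))))))
    ≡⟨ ∑<-cong n (λ x → trans (∑<-cong n (λ y → trans (*-distribˡ-∑< n (𝟙 (x ≟ a)) _)
                                                        (cong (𝟙 (x ≟ a) *_) (*-distribˡ-∑< n (𝟙 (y ≟ b)) _))))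
                              (*-distribˡ-∑< n (𝟙 (x ≟ a)) _)) ⟩
  ∑< n (λ x → 𝟙 (x ≟ a) * ∑< n (λ y → 𝟙 (y ≟ b) * ∑< n (λ z → 𝟙 (z ≟ c) * f (x , y , z))))
    ≡⟨ ∑<-δ n a _ a<n ⟩
  ∑< n (λ y → 𝟙 (y ≟ b) * ∑< n (λ z → 𝟙 (z ≟ c) * f (a , y , z)))
    ≡⟨ ∑<-δ n b _ b<n ⟩
  ∑< n (λ z → 𝟙 (z ≟ c) * f (a , b , z))
    ≡⟨ ∑<-δ n c _ c<n ⟩
  f (a , b , c) ∎
  where
  open ≡-Reasoning
  separate : ∀ x y z → 𝟙 ((x , y , z) ≟ₚ (a , b , c)) * f (x , y , z)
                     ≡ 𝟙 (x ≟ a) * (𝟙 (y ≟ b) * (𝟙 (z ≟ c) * f (x , y , z)))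
  separate x y z = trans (cong (_* f (x , y , z)) (𝟙-≟ₚ x y z a b c))
                         (reassoc (𝟙 (x ≟ a)) (𝟙 (y ≟ b)) (𝟙 (z ≟ c)) (f (x , y , z)))
    where
    reassoc : ∀ a b c d → a * (b * c) * d ≡ a * (b * (c * d))
    reassoc = solve-∀

𝟙-∈-∷ : ∀ p q (l : List Point) → q ∉ l → 𝟙 (p ∈? (q ∷ l)) ≡ 𝟙 (p ≟ₚ q) + 𝟙 (p ∈? l)
𝟙-∈-∷ p q l q∉l with p ≟ₚ q | p ∈? l
... | yes refl | yes p∈l = contradiction p∈l q∉l
... | yes _    | no _    = refl
... | no _     | yes _   = refl
... | no _     | no _    = refl

sum-map≡∑³ : ∀ n (f : Point → ℕ) (l : List Point) → Unique l → All (InBox n) l →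
             sum (map f l) ≡ ∑³ n (λ p → 𝟙 (p ∈? l) * f p)
sum-map≡∑³ n f []      _        _            = sym (∑<-zero n (λ _ _ → ∑<-zero n (λ _ _ → ∑<-zero n (λ _ _ → refl))))
sum-map≡∑³ n f (q ∷ l) (q≢l ∷ l!) (q∈box ∷ l∈box) = begin
  f q + sum (map f l)
    ≡⟨ cong₂ _+_ (sym (∑³-δ n f q q∈box)) (sum-map≡∑³ n f l l! l∈box) ⟩
  ∑³ n (λ p → 𝟙 (p ≟ₚ q) * f p) + ∑³ n (λ p → 𝟙 (p ∈? l) * f p)
    ≡⟨ ∑³-distrib-+ n _ _ ⟨
  ∑³ n (λ p → 𝟙 (p ≟ₚ q) * f p + 𝟙 (p ∈? l) * f p)
    ≡⟨ ∑³-cong n (λ p → trans (cong (_* f p) (𝟙-∈-∷ p q l (Unique[x∷xs]⇒x∉xs (q≢l ∷ l!))))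
                              (*-distribʳ-+ (f p) (𝟙 (p ≟ₚ q)) _)) ⟨
  ∑³ n (λ p → 𝟙 (p ∈? (q ∷ l)) * f p) ∎
  where open ≡-Reasoning

module _ (n : ℕ) {l : List Point} (l! : Unique l) (l∈box : All (InBox n) l) where

  length≡∑³ : length l ≡ ∑³ n (𝟙 ∘ (_∈? l))
  length≡∑³ = trans (length≡sum-map-1 l) (trans (sum-map≡∑³ n (λ _ → 1) l l! l∈box)
                                                 (∑³-cong n (λ p → *-identityʳ (𝟙 (p ∈? l)))))

  length-filter≡∑³ : ∀ {P : Point → Set} (P? : Decidable P) →
                     length (filter P? l) ≡ ∑³ n (λ p → 𝟙 (p ∈? l) * 𝟙 (P? p))
  length-filter≡∑³ P? = trans (length-filter≡sum P? l) (sum-map≡∑³ n (𝟙 ∘ P?) l l! l∈box)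

  sum-map-filter≡∑³ : ∀ (f : Point → ℕ) {P : Point → Set} (P? : Decidable P) →
                      sum (map f (filter P? l)) ≡ ∑³ n (λ p → 𝟙 (p ∈? l) * (𝟙 (P? p) * f p))
  sum-map-filter≡∑³ f P? = trans (sum-map-filter P? f l) (sum-map≡∑³ n _ l l! l∈box)

∣_∣ : Point → ℕ
∣ x , y , z ∣ = x + (y + z)

module Volumes (Λ : SolidPartition) where

  n : ℕ
  n = suc (sum (map ∣_∣ (cells Λ)))

  cell-InBox : ∀ {p} → p ∈ cells Λ → InBox n p
  cell-InBox {x , y , z} p∈Λ = s≤s (≤-trans (m≤m+n x (y + z)) ∣p∣≤) ,
                               s≤s (≤-trans (≤-trans (m≤m+n y z) (m≤n+m (y + z) x)) ∣p∣≤) ,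
                               s≤s (≤-trans (≤-trans (m≤n+m z y) (m≤n+m (y + z) x)) ∣p∣≤)
    where
    ∣p∣≤ : x + (y + z) ≤ sum (map ∣_∣ (cells Λ))
    ∣p∣≤ = ∈⇒≤sum (∈-map⁺ ∣_∣ p∈Λ)

  cells-InBox : All (InBox n) (cells Λ)
  cells-InBox = All.tabulate cell-InBox

  V≡∑³ : ∀ p → V Λ p ≡ ∑³ n (λ q → 𝟙 (q ∈? cells Λ) * 𝟙 (p ≼? q))
  V≡∑³ p = length-filter≡∑³ n (unique Λ) cells-InBox (p ≼?_)

  V*≡∑³ : ∀ p → V* Λ p ≡ ∑³ n (λ q → 𝟙 (q ∈? cells Λ) * 𝟙 (q ≼? p))
  V*≡∑³ p = length-filter≡∑³ n (unique Λ) cells-InBox (_≼? p)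

  V≡∑³-translate : ∀ p → V Λ p ≡ ∑³ n (λ d → 𝟙 (p ⊕ d ∈? cells Λ))
  V≡∑³-translate p = begin
    V Λ p                                                ≡⟨ V≡∑³ p ⟩
    ∑³ n (λ q → 𝟙 (q ∈? cells Λ) * 𝟙 (p ≼? q))          ≡⟨ ∑³-cong n (λ q → *-comm (𝟙 (q ∈? cells Λ)) _) ⟩
    ∑³ n (λ q → 𝟙 (p ≼? q) * 𝟙 (q ∈? cells Λ))          ≡⟨ ∑³-translate n (λ q q∉box → 𝟙-no (q∉box ∘ cell-InBox) (q ∈? cells Λ)) p ⟨
    ∑³ n (λ d → 𝟙 (p ⊕ d ∈? cells Λ))                   ∎
    where open ≡-Reasoning

  V*≤∑³ : ∀ p → V* Λ p ≤ ∑³ n (λ q → 𝟙 (q ≼? p))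
  V*≤∑³ p = ≤-trans (≤-reflexive (V*≡∑³ p)) (∑³-mono-≤ n (λ q → m*n≤n (𝟙≤1 (q ∈? cells Λ))))
    where
    m*n≤n : ∀ {m} {k} → m ≤ 1 → m * k ≤ k
    m*n≤n {k = k} m≤1 = ≤-trans (*-monoˡ-≤ k m≤1) (≤-reflexive (*-identityˡ k))

  sum-volumes≡sum-antiVolumes : sum (volumes Λ) ≡ sum (antiVolumes Λ)
  sum-volumes≡sum-antiVolumes = begin
    sum (map (V Λ) (cells Λ))
      ≡⟨ sum-map≡∑³ n (V Λ) (cells Λ) (unique Λ) cells-InBox ⟩
    ∑³ n (λ x → 𝟙 (x ∈? cells Λ) * V Λ x)
      ≡⟨ ∑³-cong n (λ x → cong (𝟙 (x ∈? cells Λ) *_) (V≡∑³ x)) ⟩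
    ∑³ n (λ x → 𝟙 (x ∈? cells Λ) * ∑³ n (λ y → 𝟙 (y ∈? cells Λ) * 𝟙 (x ≼? y)))
      ≡⟨ ∑³-comm-*ˡ n (λ x → 𝟙 (x ∈? cells Λ)) (λ x y → 𝟙 (y ∈? cells Λ) * 𝟙 (x ≼? y)) ⟩
    ∑³ n (λ y → ∑³ n (λ x → 𝟙 (x ∈? cells Λ) * (𝟙 (y ∈? cells Λ) * 𝟙 (x ≼? y))))
      ≡⟨ ∑³-cong n (λ y → ∑³-cong n (λ x → x∙yz≈y∙xz (𝟙 (x ∈? cells Λ)) (𝟙 (y ∈? cells Λ)) _)) ⟩
    ∑³ n (λ y → ∑³ n (λ x → 𝟙 (y ∈? cells Λ) * (𝟙 (x ∈? cells Λ) * 𝟙 (x ≼? y))))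
      ≡⟨ ∑³-cong n (λ y → trans (*-distribˡ-∑³ n (𝟙 (y ∈? cells Λ)) _)
                                (cong (𝟙 (y ∈? cells Λ) *_) (sym (V*≡∑³ y)))) ⟩
    ∑³ n (λ y → 𝟙 (y ∈? cells Λ) * V* Λ y)
      ≡⟨ sum-map≡∑³ n (V* Λ) (cells Λ) (unique Λ) cells-InBox ⟨
    sum (map (V* Λ) (cells Λ)) ∎
    where open ≡-Reasoning

  sum-V*≤sum-V : ∀ S R → cells Λ ↭ S ++ R →
    ∃₂ λ T U → cells Λ ↭ T ++ U × length T ≡ length S × sum (map (V* Λ) S) ≤ sum (map (V Λ) T)
  sum-V*≤sum-V S R Λ↭S++R = T , U , ↭-filter-++ compressed? (cells Λ) , |T|≡|S| , ΣV*≤ΣV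
    where
    S! : Unique S
    S! = Unique-++⁻ˡ S (Unique-resp-↭ Λ↭S++R (unique Λ))

    S⊆Λ : ∀ {p} → p ∈ S → p ∈ cells Λ
    S⊆Λ p∈S = ∈-resp-↭ (↭-sym Λ↭S++R) (∈-++⁺ˡ p∈S)

    S-InBox : All (InBox n) S
    S-InBox = All.tabulate (cell-InBox ∘ S⊆Λ)

    open Compression n (_∈? S) (_∈? cells Λ) S⊆Λ (lower Λ)

    T U : List Point
    T = filter compressed? (cells Λ)
    U = filter (¬? ∘ compressed?) (cells Λ)

    𝟙-Compressed : ∀ p → 𝟙 (p ∈? cells Λ) * 𝟙 (compressed? p) ≡ 𝟙 (compressed? p)
    𝟙-Compressed p = trans (*-comm (𝟙 (p ∈? cells Λ)) _) (𝟙-⇒ Compressed⊆L (compressed? p) (p ∈? cells Λ))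

    |T|≡|S| : length T ≡ length S
    |T|≡|S| = begin
      length T                                            ≡⟨ length-filter≡∑³ n (unique Λ) cells-InBox compressed? ⟩
      ∑³ n (λ p → 𝟙 (p ∈? cells Λ) * 𝟙 (compressed? p))  ≡⟨ ∑³-cong n 𝟙-Compressed ⟩
      ∑³ n (𝟙 ∘ compressed?)                              ≡⟨ ∣Compressed∣≡∣S∣ ⟩
      ∑³ n (𝟙 ∘ (_∈? S))                                  ≡⟨ length≡∑³ n S! S-InBox ⟨
      length S                                            ∎
      where open ≡-Reasoning

    ΣV*≤ΣV : sum (map (V* Λ) S) ≤ sum (map (V Λ) T)
    ΣV*≤ΣV = begin
      sum (map (V* Λ) S)
        ≡⟨ sum-map≡∑³ n (V* Λ) S S! S-InBox ⟩
      ∑³ n (λ z → 𝟙 (z ∈? S) * V* Λ z)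
        ≤⟨ ∑³-mono-≤ n (λ z → *-monoʳ-≤ (𝟙 (z ∈? S)) (V*≤∑³ z)) ⟩
      ∑³ n (λ z → 𝟙 (z ∈? S) * ∑³ n (λ d → 𝟙 (d ≼? z)))
        ≡⟨ ∑³-comm-*ˡ n (λ z → 𝟙 (z ∈? S)) (λ z d → 𝟙 (d ≼? z)) ⟩
      ∑³ n (λ d → ∑³ n (λ z → 𝟙 (z ∈? S) * 𝟙 (d ≼? z)))
        ≤⟨ ∑³-mono-≤ n compression-shift ⟩
      ∑³ n (λ d → ∑³ n (λ p → 𝟙 (compressed? p) * 𝟙 (p ⊕ d ∈? cells Λ)))
        ≡⟨ ∑³-comm-*ˡ n (𝟙 ∘ compressed?) (λ p d → 𝟙 (p ⊕ d ∈? cells Λ)) ⟨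
      ∑³ n (λ p → 𝟙 (compressed? p) * ∑³ n (λ d → 𝟙 (p ⊕ d ∈? cells Λ)))
        ≡⟨ ∑³-cong n (λ p → cong (𝟙 (compressed? p) *_) (V≡∑³-translate p)) ⟨
      ∑³ n (λ p → 𝟙 (compressed? p) * V Λ p)
        ≡⟨ ∑³-cong n (λ p → trans (sym (*-assoc (𝟙 (p ∈? cells Λ)) _ _)) (cong (_* V Λ p) (𝟙-Compressed p))) ⟨
      ∑³ n (λ p → 𝟙 (p ∈? cells Λ) * (𝟙 (compressed? p) * V Λ p))
        ≡⟨ sum-map-filter≡∑³ n (unique Λ) cells-InBox (V Λ) compressed? ⟨
      sum (map (V Λ) T) ∎
      where open ≤-Reasoning

open Volumes using (sum-volumes≡sum-antiVolumes; sum-V*≤sum-V)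

module _ (Λ : SolidPartition) {a b : List ℕ} (a↭ : a ↭ volumes Λ) (b↭ : b ↭ antiVolumes Λ)
         (a↓ : NonIncreasing a) (k : ℕ) where

  private
    first-k : ∃₂ λ S R → cells Λ ↭ S ++ R × map (V* Λ) S ≡ take k b
    first-k = split-map-↭ (V* Λ) (take k b) (drop k b) (cells Λ)
                          (subst (_↭ antiVolumes Λ) (sym (take++drop≡id k b)) b↭)

    S R : List Point
    S = proj₁ first-k
    R = proj₁ (proj₂ first-k)

    V*S≡take-k : map (V* Λ) S ≡ take k b
    V*S≡take-k = proj₂ (proj₂ (proj₂ first-k))

    dominating : ∃₂ λ T U → cells Λ ↭ T ++ U × length T ≡ length S × sum (map (V* Λ) S) ≤ sum (map (V Λ) T)
    dominating = sum-V*≤sum-V Λ S R (proj₁ (proj₂ (proj₂ first-k)))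

    T U : List Point
    T = proj₁ dominating
    U = proj₁ (proj₂ dominating)

    VT++VU↭a : map (V Λ) T ++ map (V Λ) U ↭ a
    VT++VU↭a = subst (_↭ a) (map-++ (V Λ) T U)
                     (↭-trans (map⁺ (V Λ) (↭-sym (proj₁ (proj₂ (proj₂ dominating))))) (↭-sym a↭))

    |VT|≤k : length (map (V Λ) T) ≤ k
    |VT|≤k = begin
      length (map (V Λ) T)   ≡⟨ length-map (V Λ) T ⟩
      length T               ≡⟨ proj₁ (proj₂ (proj₂ (proj₂ dominating))) ⟩
      length S               ≡⟨ length-map (V* Λ) S ⟨
      length (map (V* Λ) S)  ≡⟨ cong length V*S≡take-k ⟩
      length (take k b)      ≡⟨ length-take k b ⟩
      k ⊓ length b           ≤⟨ m⊓n≤m k (length b) ⟩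
      k                      ∎
      where open ≤-Reasoning

  sum-take-antiVolumes≤sum-take-volumes : sum (take k b) ≤ sum (take k a)
  sum-take-antiVolumes≤sum-take-volumes = begin
    sum (take k b)       ≡⟨ cong sum V*S≡take-k ⟨
    sum (map (V* Λ) S)   ≤⟨ proj₂ (proj₂ (proj₂ (proj₂ dominating))) ⟩
    sum (map (V Λ) T)    ≤⟨ sum≤sum-take a a↓ (map (V Λ) T) (map (V Λ) U) k VT++VU↭a |VT|≤k ⟩
    sum (take k a)       ∎
    where open ≤-Reasoning

theorem5p3 : (Λ : SolidPartition) → Majorizes (volumes Λ) (antiVolumes Λ)
theorem5p3 Λ = same-length , λ a b a↭ b↭ a↓ _ →
  sum-take-antiVolumes≤sum-take-volumes Λ a↭ b↭ a↓ ,
  trans (sum-↭ a↭) (trans (sum-volumes≡sum-antiVolumes Λ) (sym (sum-↭ b↭)))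
  where
  same-length : length (volumes Λ) ≡ length (antiVolumes Λ)
  same-length = trans (length-map (V Λ) (cells Λ)) (sym (length-map (V* Λ) (cells Λ)))
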